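{- Let $\Gamma$ be a finite, connected, simple, undirected graph with at least one edge, $G$ a group, and $s_2\in Z(G)$ with $s_2^2=1_G$. For $H_1,H_2\in\mathcal H_\Gamma$, one has $H_1\sim_l H_2$ if and only if $\Psi_L(H_1)=\Psi_L(H_2)$. That is, the orbits of the action $l$ on $\mathcal H_\Gamma$ are exactly the fibers of $\Psi_L$.
   Context: Fix orders $V_\Gamma=\{v_1,\dots,v_n\}$, $E_\Gamma=\{e_1,\dots,e_m\}$; write $v_i\in e_j$ if $v_i$ is an endpoint of $e_j$, and $e_i\cap e_j$ for the common endpoint of distinct edges sharing a vertex. $\mathbb CG$ is the complex group algebra with involution $(\sum f_xx)^*=\sum\overline{f_x}x^{ -1}$, and $(A^*)_{i,j}=(A_{j,i})^*$ for matrices over it. A $G$-phase of $\Gamma$ is $H\in M_{n\times m}(\mathbb CG)$ with $H_{i,j}\in G$ if $v_i\in e_j$ and $H_{i,j}=0$ otherwise; $\mathcal H_\Gamma$ is their set. For $f\in G^n$, $\underline f=\mathrm{diag}(f_1,\dots,f_n)$; the action $l$ of $G^n$ on $\mathcal H_\Gamma$ is $l(f,H)=\underline f^{\,*}H$, and $H_1\sim_l H_2$ means $H_1=\underline f^{\,*}H_2$ for some $f\in G^n$. The line graph $L(\Gamma)$ has vertex set $E_\Gamma$, with $e_i\sim e_j$ iff they share an endpoint. $\Psi_L(H)$ is the $G$-gain function on $L(\Gamma)$ given by $\Psi_L(H)(e_i,e_j)=s_2H_{k,i}^{ -1}H_{k,j}$ where $v_k=e_i\cap e_j$. -}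

module Defs where

open import Level using (Level; _⊔_)
open import Data.Nat using (ℕ; _≥_)
open import Data.Fin using (Fin)
open import Data.Product using (_×_; _,_; proj₁; proj₂; ∃; Σ)
open import Data.Sum using (_⊎_)
open import Relation.Binary.PropositionalEquality using (_≡_; _≢_)
open import Relation.Nullary using (¬_)
open import Algebra.Bundles using (Group)

-- A finite graph with vertices Fin n and edges Fin m (fixed orders v_i, e_j);
-- each edge is given by its (ordered for bookkeeping) pair of endpoints.
record Graph (n m : ℕ) : Set where
  field
    ends : Fin m → Fin n × Fin n

  _∈ₑ_ : Fin n → Fin m → Set
  v ∈ₑ e = v ≡ proj₁ (ends e) ⊎ v ≡ proj₂ (ends e)

  Adj : Fin n → Fin n → Set
  Adj u v = ∃ λ e → u ∈ₑ e × v ∈ₑ e × u ≢ v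

open Graph public

record IsSimple {n m : ℕ} (Γ : Graph n m) : Set where
  field
    noLoop : ∀ e → proj₁ (ends Γ e) ≢ proj₂ (ends Γ e)
    noMulti : ∀ e e′ → (∀ v → (_∈ₑ_ Γ v e → _∈ₑ_ Γ v e′) × (_∈ₑ_ Γ v e′ → _∈ₑ_ Γ v e)) → e ≡ e′

data Reach {n m : ℕ} (Γ : Graph n m) : Fin n → Fin n → Set where
  here : ∀ {u} → Reach Γ u u
  step : ∀ {u v w} → Adj Γ u v → Reach Γ v w → Reach Γ u w

Connected : {n m : ℕ} → Graph n m → Set
Connected Γ = ∀ u v → Reach Γ u v

module _ {c ℓ : Level} (G : Group c ℓ) where
  open Group G

  Central : Carrier → Set (c ⊔ ℓ)
  Central s = ∀ g → s ∙ g ≈ g ∙ s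

  -- A G-phase H ∈ M_{n×m}(ℂG): entries at incidences are elements of G;
  -- the other entries are 0 and carry no data, so H is represented by its
  -- entry function, only ever consulted at incident pairs (v_i ∈ e_j).
  Phase : ℕ → ℕ → Set c
  Phase n m = Fin n → Fin m → Carrier

  module _ {n m : ℕ} (Γ : Graph n m) where

    -- H₁ ∼_l H₂ :  H₁ = f̲* H₂ for some f ∈ Gⁿ, i.e. (H₁)_{ij} = f_i⁻¹ (H₂)_{ij}
    -- at every incident entry (non-incident entries are 0 on both sides).
    _∼ₗ_ : Phase n m → Phase n m → Set (c ⊔ ℓ)
    H₁ ∼ₗ H₂ = Σ (Fin n → Carrier) λ f →
      ∀ i j → _∈ₑ_ Γ i j → H₁ i j ≈ (f i ⁻¹) ∙ H₂ i j

    -- Ψ_L(H)(e_i, e_j) = s₂ H_{k,i}⁻¹ H_{k,j} where v_k = e_i ∩ e_j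
    ΨL : Carrier → Phase n m → (i j : Fin m) (k : Fin n) → Carrier
    ΨL s₂ H i j k = s₂ ∙ ((H k i ⁻¹) ∙ H k j)

    -- equality of gain functions on L(Γ): on every ordered pair of adjacent
    -- (distinct, endpoint-sharing) edges, with k their common endpoint
    _≈Ψ_ : Carrier → Phase n m → Phase n m → Set ℓ
    (s₂ ≈Ψ H₁) H₂ = ∀ (i j : Fin m) (k : Fin n) → i ≢ j →
      _∈ₑ_ Γ k i → _∈ₑ_ Γ k j → ΨL s₂ H₁ i j k ≈ ΨL s₂ H₂ i j k

-- The action l multiplies the entries at each vertex v_k on the left by one
-- group element, and in a group the left quotients x⁻¹y are exactly the
-- invariants of a common left translation: x⁻¹y = x′⁻¹y′ forces y = g⁻¹y′
-- with g = x′x⁻¹.  Since s₂ is cancelled from Ψ_L, equality of Ψ_L says that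
-- at every vertex the left quotients of H₁ and H₂ agree, and translating by
-- g_k read off from any edge at v_k gives H₁ ∼_l H₂.  The argument is local
-- at each vertex and uses no property of s₂.
module Submission where

open import Defs
open import Level using (Level)
open import Data.Nat using (ℕ; _≥_)
open import Data.Fin using (Fin)
open import Data.Fin.Properties using (any?; _≟_)
open import Data.Product using (_×_; _,_; ∃)
open import Relation.Nullary using (Dec; yes; no; contradiction)
open import Relation.Nullary.Decidable using (_⊎-dec_)
open import Relation.Binary.PropositionalEquality using (refl)
open import Algebra.Bundles using (Group)
import Algebra.Properties.Group as GroupProperties
import Algebra.Properties.Monoid as MonoidProperties
import Relation.Binary.Reasoning.Setoid as SetoidReasoning

module _ {c ℓ : Level} (G : Group c ℓ) where
  open Group G
  open GroupProperties G using (\\-cong₂; \\-leftDividesˡ; ⁻¹-anti-homo-∙; ⁻¹-anti-homo-//; ∙-cancelˡ)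
  open MonoidProperties monoid using (cancelᶜ)
  open SetoidReasoning setoid

  \\-invariantˡ : ∀ g x y → (g ∙ x) \\ (g ∙ y) ≈ x \\ y
  \\-invariantˡ g x y = begin
    (g ∙ x) ⁻¹ ∙ (g ∙ y)     ≈⟨ ∙-congʳ (⁻¹-anti-homo-∙ g x) ⟩
    (x ⁻¹ ∙ g ⁻¹) ∙ (g ∙ y)  ≈⟨ cancelᶜ (inverseˡ g) (x ⁻¹) y ⟩
    x ⁻¹ ∙ y                 ∎

  y≈x′//x\\y′ : ∀ {x y x′ y′} → x \\ y ≈ x′ \\ y′ → y ≈ (x′ // x) \\ y′
  y≈x′//x\\y′ {x} {y} {x′} {y′} eq = begin
    y                  ≈⟨ \\-leftDividesˡ x y ⟨
    x ∙ (x \\ y)       ≈⟨ ∙-congˡ eq ⟩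
    x ∙ (x′ \\ y′)     ≈⟨ assoc x (x′ ⁻¹) y′ ⟨
    (x // x′) ∙ y′     ≈⟨ ∙-congʳ (⁻¹-anti-homo-// x′ x) ⟨
    (x′ // x) \\ y′    ∎

  module _ {n m : ℕ} (Γ : Graph n m) (s₂ : Carrier) where

    ∼ₗ⇒≈Ψ : ∀ {H₁ H₂} → _∼ₗ_ G Γ H₁ H₂ → _≈Ψ_ G Γ s₂ H₁ H₂
    ∼ₗ⇒≈Ψ {H₁} {H₂} (f , H₁≈fH₂) i j k _ k∈i k∈j = ∙-congˡ (begin
      H₁ k i \\ H₁ k j                             ≈⟨ \\-cong₂ (H₁≈fH₂ k i k∈i) (H₁≈fH₂ k j k∈j) ⟩
      (f k ⁻¹ ∙ H₂ k i) \\ (f k ⁻¹ ∙ H₂ k j)       ≈⟨ \\-invariantˡ (f k ⁻¹) (H₂ k i) (H₂ k j) ⟩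
      H₂ k i \\ H₂ k j                             ∎)

    incidentEdge? : ∀ k → Dec (∃ λ e → _∈ₑ_ Γ k e)
    incidentEdge? k = any? λ e → (k ≟ _) ⊎-dec (k ≟ _)

    ≈Ψ⇒\\-agree : ∀ {H₁ H₂ k e j} → _≈Ψ_ G Γ s₂ H₁ H₂ → _∈ₑ_ Γ k e → _∈ₑ_ Γ k j →
                  H₁ k e \\ H₁ k j ≈ H₂ k e \\ H₂ k j
    ≈Ψ⇒\\-agree {H₁} {H₂} {k} {e} {j} ψ k∈e k∈j with e ≟ j
    ... | yes refl = trans (inverseˡ (H₁ k e)) (sym (inverseˡ (H₂ k e)))
    ... | no e≢j   = ∙-cancelˡ s₂ _ _ (ψ e j k e≢j k∈e k∈j)

    gauge : Phase G n m → Phase G n m → Fin n → Carrier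
    gauge H₁ H₂ k with incidentEdge? k
    ... | yes (e , _) = H₂ k e // H₁ k e
    ... | no _        = ε

    ≈Ψ⇒∼ₗ : ∀ {H₁ H₂} → _≈Ψ_ G Γ s₂ H₁ H₂ → _∼ₗ_ G Γ H₁ H₂
    ≈Ψ⇒∼ₗ {H₁} {H₂} ψ = gauge H₁ H₂ , translate
      where
      translate : ∀ k j → _∈ₑ_ Γ k j → H₁ k j ≈ gauge H₁ H₂ k \\ H₂ k j
      translate k j k∈j with incidentEdge? k
      ... | yes (e , k∈e) = y≈x′//x\\y′ (≈Ψ⇒\\-agree ψ k∈e k∈j)
      ... | no ∄e         = contradiction (j , k∈j) ∄e

theorem4p21 : ∀ {c ℓ : Level} (G : Group c ℓ) {n m : ℕ} (Γ : Graph n m) →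
    IsSimple Γ → Connected Γ → m ≥ 1 →
    (s₂ : Group.Carrier G) → Central G s₂ →
    Group._≈_ G (Group._∙_ G s₂ s₂) (Group.ε G) →
    (H₁ H₂ : Phase G n m) →
    (_∼ₗ_ G Γ H₁ H₂ → _≈Ψ_ G Γ s₂ H₁ H₂) × (_≈Ψ_ G Γ s₂ H₁ H₂ → _∼ₗ_ G Γ H₁ H₂)
theorem4p21 G Γ _ _ _ s₂ _ _ _ _ = ∼ₗ⇒≈Ψ G Γ s₂ , ≈Ψ⇒∼ₗ G Γ s₂
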